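{- Let $m\geq 3$ and $1\leq s\leq \lfloor (m-1)/2\rfloor$ be integers with $\gcd(m,s)=1$. Then $\mbox{min-seed}(P(m,s),2)=\lceil (m+1)/2\rceil$.
   Context: The generalized Petersen graph $P(m,s)$ has vertex set $\{v_1,\dots,v_m,u_1,\dots,u_m\}$ and edge set $\{v_iv_{i+1},\,u_iv_i,\,u_iu_{i+s}: i=1,\dots,m\}$, subscripts modulo $m$. For a graph $G$ and positive integer $k$, the activation process in $(G,k)$ starting at $S\subseteq V(G)$: at time $0$ exactly the vertices of $S$ are active; at each subsequent step every inactive vertex with at least $k$ active neighbors becomes active; active vertices stay active; the process stops when nothing changes. $\mbox{min-seed}(G,k)$ is the minimum size of a set $S\subseteq V(G)$ such that at the end of this process all vertices of $G$ are active. -}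

module Defs where

open import Data.Nat using (ℕ; zero; suc; _+_; _≤_; _≤ᵇ_; _≡ᵇ_; NonZero)
open import Data.Nat.DivMod using (_%_)
open import Data.Fin using (Fin; toℕ)
open import Data.List using (List; []; _∷_; map; _++_; allFin)
open import Data.Sum using (_⊎_; inj₁; inj₂)
open import Data.Bool using (Bool; true; false; _∧_; _∨_; T)
open import Data.Product using (Σ; _×_; _,_)
open import Relation.Binary.PropositionalEquality using (_≡_)

-- A finite graph: vertex type, a list enumerating each vertex exactly once,
-- and a symmetric Boolean adjacency relation.
record Graph : Set₁ where
  field
    V     : Set
    verts : List V
    adj   : V → V → Bool

countB : {A : Set} → (A → Bool) → List A → ℕ
countB p [] = 0
countB p (x ∷ xs) with p x
... | true  = suc (countB p xs)
... | false = countB p xs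

module _ (G : Graph) where
  open Graph G

  VSet : Set
  VSet = V → Bool

  size : VSet → ℕ
  size S = countB S verts

  activeNbrs : VSet → V → ℕ
  activeNbrs S x = countB (λ y → adj x y ∧ S y) verts

  step : ℕ → VSet → VSet
  step k S x = S x ∨ (k ≤ᵇ activeNbrs S x)

  activeAt : ℕ → VSet → ℕ → VSet
  activeAt k S zero    = S
  activeAt k S (suc t) = step k (activeAt k S t)

  -- all vertices are active at the end of the process
  -- (the process is monotone, so this holds iff at some time all are active)
  Percolates : ℕ → VSet → Set
  Percolates k S = Σ ℕ λ t → ∀ x → T (activeAt k S t x)

  MinSeedIs : ℕ → ℕ → Set
  MinSeedIs k r =
    (Σ VSet λ S → size S ≡ r × Percolates k S)
    × (∀ S → Percolates k S → r ≤ size S)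

-- generalized Petersen graph P(m,s):  inj₁ i = v_i, inj₂ i = u_i  (indices 0..m-1)
-- edges v_i v_{i+1}, u_i v_i, u_i u_{i+s}  (indices mod m)
Petersen : (m s : ℕ) → .{{_ : NonZero m}} → Graph
Petersen m s = record
  { V     = Fin m ⊎ Fin m
  ; verts = map inj₁ (allFin m) ++ map inj₂ (allFin m)
  ; adj   = adjP
  }
  where
  shift : ℕ → Fin m → Fin m → Bool
  shift d i j = ((toℕ j) ≡ᵇ ((toℕ i + d) % m)) Data.Bool.∨ ((toℕ i) ≡ᵇ ((toℕ j + d) % m))
  adjP : Fin m ⊎ Fin m → Fin m ⊎ Fin m → Bool
  adjP (inj₁ i) (inj₁ j) = shift 1 i j
  adjP (inj₂ i) (inj₂ j) = shift s i j
  adjP (inj₁ i) (inj₂ j) = toℕ i ≡ᵇ toℕ j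
  adjP (inj₂ i) (inj₁ j) = toℕ i ≡ᵇ toℕ j

-- Lower bound (valid in every simple 3-regular graph on n ≥ 1 vertices):
-- every seed S with which threshold-2 activation spreads everywhere has
-- 4|S| ≥ n + 2.  Let cut(A) be the number of edges between the active set A
-- and its complement.  A vertex that becomes active has at least 2 active and
-- hence at most 1 inactive neighbour, so one round activating D vertices
-- lowers cut by at least D: the weight cut(A) + |A| never increases.  In the
-- final round, where the last D ≥ 1 inactive vertices switch on, the drop is
-- at least 2 (a lone last vertex has 3 active neighbours; otherwise each of
-- the D ≥ 2 vertices loses ≥ 2 cut edges).  Hence n + 2 ≤ cut(S) + |S| ≤ 4|S|.
-- For P(m,s), n = 2m, which gives |S| ≥ ⌊m/2⌋ + 1 = ⌈(m+1)/2⌉.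
--
-- Upper bound: the seed {v_k : k odd} ∪ {u_0} has ⌈(m+1)/2⌉ elements.  By time 2
-- the whole outer cycle is active; then u_{(n+1)s} has the active neighbours
-- u_{ns} and v_{(n+1)s}, and since gcd(m,s) = 1 the multiples of s reach every
-- residue, so every u_i is active by time m + 2.
module Submission where

open import Defs
open import Data.Nat using (ℕ; zero; suc; _+_; _*_; _∸_; _≤_; _<_; _≤ᵇ_; _≡ᵇ_; _≤?_; _<?_; z≤n; s≤s; s≤s⁻¹; NonZero; >-nonZero⁻¹; pred; ⌊_/2⌋; ⌈_/2⌉)
open import Data.Nat.Properties
open import Data.Nat.DivMod using (_%_; m%n<n; m<n⇒m%n≡m; m%n%n≡m%n; n%n≡0; [m+n]%n≡m%n; [m+kn]%n≡m%n; %-distribˡ-+; %-distribˡ-*)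
open import Data.Nat.GCD using (gcd; gcd-GCD; module Bézout)
open import Data.Nat.Solver using (module +-*-Solver)
open import Algebra.Properties.CommutativeSemigroup +-commutativeSemigroup using (interchange; x∙yz≈y∙xz)
open import Data.Bool using (Bool; true; false; _∧_; _∨_; not; T)
open import Data.Bool.Properties using (∨-comm; not-injective; T-≡; T-∧; T-∨)
open import Data.Unit using (tt)
open import Data.Fin using (Fin; toℕ; fromℕ<)
import Data.Fin as Fin
open import Data.Fin.Properties using (toℕ-injective; toℕ-fromℕ<; toℕ<n)
open import Data.List using (List; []; _∷_; map; _++_; allFin; tabulate; length)
open import Data.List.Properties using (map-tabulate; length-tabulate)
open import Data.List.Membership.Propositional using (_∈_)
open import Data.List.Membership.Propositional.Properties using (∈-++⁺ˡ; ∈-++⁺ʳ; ∈-map⁺; ∈-allFin)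
open import Data.List.Relation.Unary.All using (All; []; _∷_)
open import Data.List.Relation.Unary.AllPairs using ([]; _∷_)
open import Data.List.Relation.Unary.Any using (here; there)
open import Data.List.Relation.Unary.Unique.Propositional using (Unique)
open import Data.List.Relation.Unary.Unique.Propositional.Properties using (allFin⁺)
open import Data.Product using (Σ; _×_; _,_; proj₁; proj₂)
open import Data.Sum using (_⊎_; inj₁; inj₂; [_,_]′)
open import Data.Sum.Properties using (inj₁-injective)
open import Function using (_∘_)
open import Function.Bundles using (Equivalence)
open import Relation.Nullary using (¬_; yes; no; contradiction)
open import Relation.Binary.PropositionalEquality

⟦_⟧ : Bool → ℕ
⟦ true ⟧  = 1
⟦ false ⟧ = 0

⟦⟧≤1 : ∀ b → ⟦ b ⟧ ≤ 1
⟦⟧≤1 true  = ≤-refl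
⟦⟧≤1 false = z≤n

T⇒1≤⟦⟧ : ∀ {b} → T b → 1 ≤ ⟦ b ⟧
T⇒1≤⟦⟧ {true} _ = ≤-refl

⟦∧⟧ : ∀ b c → ⟦ b ∧ c ⟧ ≡ ⟦ b ⟧ * ⟦ c ⟧
⟦∧⟧ true  c = sym (+-identityʳ ⟦ c ⟧)
⟦∧⟧ false c = refl

⟦∨⟧ : ∀ b c → ⟦ b ∨ c ⟧ ≤ ⟦ b ⟧ + ⟦ c ⟧
⟦∨⟧ true  c = s≤s z≤n
⟦∨⟧ false c = ≤-refl

⟦b⟧+⟦¬b⟧ : ∀ b → ⟦ b ⟧ + ⟦ not b ⟧ ≡ 1
⟦b⟧+⟦¬b⟧ true  = refl
⟦b⟧+⟦¬b⟧ false = refl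

indicator-scale : ∀ b {p q} → (T b → p ≤ q) → ⟦ b ⟧ * p ≤ ⟦ b ⟧ * q
indicator-scale true  h = +-monoˡ-≤ 0 (h tt)
indicator-scale false h = z≤n

indicator-positive : ∀ b k → 1 ≤ ⟦ b ⟧ * k → T b × 1 ≤ k
indicator-positive true k h = tt , subst (1 ≤_) (+-identityʳ k) h

∑ : {A : Set} → List A → (A → ℕ) → ℕ
∑ []       f = 0
∑ (x ∷ xs) f = f x + ∑ xs f

module _ {A : Set} where

  ∑-cong : (xs : List A) {f g : A → ℕ} → (∀ x → f x ≡ g x) → ∑ xs f ≡ ∑ xs g
  ∑-cong []       e = refl
  ∑-cong (x ∷ xs) e = cong₂ _+_ (e x) (∑-cong xs e)

  ∑-mono : (xs : List A) {f g : A → ℕ} → (∀ x → f x ≤ g x) → ∑ xs f ≤ ∑ xs g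
  ∑-mono []       e = z≤n
  ∑-mono (x ∷ xs) e = +-mono-≤ (e x) (∑-mono xs e)

  ∑-zero : (xs : List A) → ∑ xs (λ _ → 0) ≡ 0
  ∑-zero []       = refl
  ∑-zero (x ∷ xs) = ∑-zero xs

  ∑-+ : (xs : List A) (f g : A → ℕ) → ∑ xs (λ x → f x + g x) ≡ ∑ xs f + ∑ xs g
  ∑-+ []       f g = refl
  ∑-+ (x ∷ xs) f g =
    trans (cong (f x + g x +_) (∑-+ xs f g)) (interchange (f x) (g x) (∑ xs f) (∑ xs g))

  ∑-*ˡ : (xs : List A) (c : ℕ) (f : A → ℕ) → ∑ xs (λ x → c * f x) ≡ c * ∑ xs f
  ∑-*ˡ []       c f = sym (*-zeroʳ c)
  ∑-*ˡ (x ∷ xs) c f = trans (cong (c * f x +_) (∑-*ˡ xs c f)) (sym (*-distribˡ-+ c (f x) (∑ xs f)))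

  ∑-*ʳ : (xs : List A) (c : ℕ) (f : A → ℕ) → ∑ xs (λ x → f x * c) ≡ ∑ xs f * c
  ∑-*ʳ xs c f = trans (∑-cong xs (λ x → *-comm (f x) c)) (trans (∑-*ˡ xs c f) (*-comm c (∑ xs f)))

  ∑-swap : (xs ys : List A) (f : A → A → ℕ) →
           ∑ xs (λ x → ∑ ys (f x)) ≡ ∑ ys (λ y → ∑ xs (λ x → f x y))
  ∑-swap []       ys f = sym (∑-zero ys)
  ∑-swap (x ∷ xs) ys f =
    trans (cong (∑ ys (f x) +_) (∑-swap xs ys f)) (sym (∑-+ ys (f x) (λ y → ∑ xs (λ x' → f x' y))))

  ∑-≥-term : (xs : List A) (f : A → ℕ) {x : A} {k : ℕ} → x ∈ xs → k ≤ f x → k ≤ ∑ xs f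
  ∑-≥-term (y ∷ xs) f (here refl) le = ≤-trans le (m≤m+n (f y) _)
  ∑-≥-term (y ∷ xs) f (there p)   le = ≤-trans (∑-≥-term xs f p le) (m≤n+m _ (f y))

  ∑-≥-two : (xs : List A) (f : A → ℕ) {x y : A} → x ∈ xs → y ∈ xs → ¬ x ≡ y →
            1 ≤ f x → 1 ≤ f y → 2 ≤ ∑ xs f
  ∑-≥-two (z ∷ xs) f (here refl) (here refl) x≢y _ _ = contradiction refl x≢y
  ∑-≥-two (z ∷ xs) f (here refl) (there q)   x≢y a b = +-mono-≤ a (∑-≥-term xs f q b)
  ∑-≥-two (z ∷ xs) f (there p)   (here refl) x≢y a b = +-mono-≤ b (∑-≥-term xs f p a)
  ∑-≥-two (z ∷ xs) f (there p)   (there q)   x≢y a b = ≤-trans (∑-≥-two xs f p q x≢y a b) (m≤n+m _ (f z))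

  ∑-positive : (xs : List A) (f : A → ℕ) → 1 ≤ ∑ xs f → Σ A λ x → x ∈ xs × 1 ≤ f x
  ∑-positive (x ∷ xs) f h with f x in fx
  ... | zero  = let (y , y∈ , fy) = ∑-positive xs f h in y , there y∈ , fy
  ... | suc _ = x , here refl , subst (1 ≤_) (sym fx) (s≤s z≤n)

module _ {A : Set} where

  countB≡∑ : (p : A → Bool) (xs : List A) → countB p xs ≡ ∑ xs (λ x → ⟦ p x ⟧)
  countB≡∑ p []       = refl
  countB≡∑ p (x ∷ xs) with p x
  ... | true  = cong suc (countB≡∑ p xs)
  ... | false = countB≡∑ p xs

  countB-cong : {p q : A → Bool} (xs : List A) → (∀ x → p x ≡ q x) → countB p xs ≡ countB q xs
  countB-cong {p} {q} xs e =
    trans (countB≡∑ p xs) (trans (∑-cong xs (cong ⟦_⟧ ∘ e)) (sym (countB≡∑ q xs)))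

  countB-++ : (p : A → Bool) (xs ys : List A) → countB p (xs ++ ys) ≡ countB p xs + countB p ys
  countB-++ p []       ys = refl
  countB-++ p (x ∷ xs) ys with p x
  ... | true  = cong suc (countB-++ p xs ys)
  ... | false = countB-++ p xs ys

  countB-map : {B : Set} (p : B → Bool) (f : A → B) (xs : List A) → countB p (map f xs) ≡ countB (p ∘ f) xs
  countB-map p f []       = refl
  countB-map p f (x ∷ xs) with p (f x)
  ... | true  = cong suc (countB-map p f xs)
  ... | false = countB-map p f xs

  countB-∷ : (p : A → Bool) (x : A) (xs : List A) → countB p (x ∷ xs) ≡ ⟦ p x ⟧ + countB p xs
  countB-∷ p x xs with p x
  ... | true  = refl
  ... | false = refl

  countB-true : (xs : List A) → countB (λ _ → true) xs ≡ length xs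
  countB-true []       = refl
  countB-true (x ∷ xs) = cong suc (countB-true xs)

  countB-∨ : (p q : A → Bool) (xs : List A) → countB (λ x → p x ∨ q x) xs ≤ countB p xs + countB q xs
  countB-∨ p q xs = begin
    countB (λ x → p x ∨ q x) xs                  ≡⟨ countB≡∑ _ xs ⟩
    ∑ xs (λ x → ⟦ p x ∨ q x ⟧)                   ≤⟨ ∑-mono xs (λ x → ⟦∨⟧ (p x) (q x)) ⟩
    ∑ xs (λ x → ⟦ p x ⟧ + ⟦ q x ⟧)               ≡⟨ ∑-+ xs _ _ ⟩
    ∑ xs (λ x → ⟦ p x ⟧) + ∑ xs (λ x → ⟦ q x ⟧)  ≡⟨ sym (cong₂ _+_ (countB≡∑ p xs) (countB≡∑ q xs)) ⟩
    countB p xs + countB q xs                    ∎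
    where open ≤-Reasoning

  at-most-one : (p : A → Bool) (xs : List A) → Unique xs →
                (∀ x y → T (p x) → T (p y) → x ≡ y) → countB p xs ≤ 1
  at-most-one p []       _          _   = z≤n
  at-most-one p (x ∷ xs) (x∉ ∷ uniq) one with p x in px
  ... | false = at-most-one p xs uniq one
  ... | true  = s≤s (≤-reflexive (none xs x∉))
    where
    none : (ys : List A) → All (λ y → ¬ x ≡ y) ys → countB p ys ≡ 0
    none []       []            = refl
    none (y ∷ ys) (x≢y ∷ x∉ys) with p y in py
    ... | true  = contradiction (one x y (subst T (sym px) tt) (subst T (sym py) tt)) x≢y
    ... | false = none ys x∉ys

  at-least-one : (p : A → Bool) (xs : List A) {x : A} → x ∈ xs → T (p x) → 1 ≤ countB p xs
  at-least-one p xs x∈ px = subst (1 ≤_) (sym (countB≡∑ p xs)) (∑-≥-term xs _ x∈ (T⇒1≤⟦⟧ px))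

  at-least-two : (p : A → Bool) (xs : List A) {x y : A} → x ∈ xs → y ∈ xs → ¬ x ≡ y →
                 T (p x) → T (p y) → 2 ≤ countB p xs
  at-least-two p xs x∈ y∈ x≢y px py =
    subst (2 ≤_) (sym (countB≡∑ p xs)) (∑-≥-two xs _ x∈ y∈ x≢y (T⇒1≤⟦⟧ px) (T⇒1≤⟦⟧ py))

-- a newly activated vertex (≥ 2 active neighbours among ≤ 3) has ≤ 1 inactive neighbour
newcomer-arith : ∀ {a i} → 2 ≤ a → a + i ≤ 3 → i + 1 ≤ a
newcomer-arith {a} {i} 2≤a a+i≤3 = ≤-trans (+-monoˡ-≤ 1 i≤1) 2≤a
  where
  i≤1 : i ≤ 1
  i≤1 = +-cancelˡ-≤ 2 i 1 (≤-trans (+-monoˡ-≤ i 2≤a) a+i≤3)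

-- in a final round with D ≥ 2 newcomers, 2D cut edges pay for D + 2
double-gain : ∀ d → 2 ≤ d → d + 2 ≤ d * 2
double-gain d 2≤d = ≤-trans (+-monoʳ-≤ d 2≤d) (≤-reflexive (sym (trans (*-comm d 2) (cong (d +_) (+-identityʳ d)))))

-- a seed that is already everything satisfies the bound trivially
one-vertex-gain : ∀ n → 1 ≤ n → n + 2 ≤ 4 * n
one-vertex-gain n 1≤n = +-monoʳ-≤ n (≤-trans (s≤s (s≤s z≤n)) (*-monoʳ-≤ 3 1≤n))

-- the summand of an edge sum, read from the other end of the edge
*-swap-ends : ∀ a e b → a * (e * b) ≡ b * (e * a)
*-swap-ends = solve 3 (λ a e b → a :* (e :* b) := b :* (e :* a)) refl
  where open +-*-Solver using (solve; _:*_; _:=_)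

-- Boolean bookkeeping for one round: a ↦ a ∨ c, where c = "has ≥ 2 active neighbours"
active-split : ∀ a c → ⟦ a ∨ c ⟧ ≡ ⟦ a ⟧ + ⟦ (a ∨ c) ∧ not a ⟧
active-split true  c     = refl
active-split false true  = refl
active-split false false = refl

inactive-split : ∀ a c → ⟦ not a ⟧ ≡ ⟦ (a ∨ c) ∧ not a ⟧ + ⟦ not (a ∨ c) ⟧
inactive-split true  c     = refl
inactive-split false true  = refl
inactive-split false false = refl

inactive-shrinks : ∀ a c → ⟦ not (a ∨ c) ⟧ ≤ ⟦ not a ⟧
inactive-shrinks true  c     = z≤n
inactive-shrinks false true  = z≤n
inactive-shrinks false false = ≤-refl

newly-active⇒cause : ∀ a c → T ((a ∨ c) ∧ not a) → T c
newly-active⇒cause false true _ = tt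

complete⇒new≡inactive : ∀ a c → T (a ∨ c) → ⟦ (a ∨ c) ∧ not a ⟧ ≡ ⟦ not a ⟧
complete⇒new≡inactive true  c    _ = refl
complete⇒new≡inactive false true _ = refl

-- Lower bound: 4|S| ≥ n + 2 for threshold-2 activation in simple cubic graphs
module CubicGraph (G : Graph)
  (adj-sym : ∀ x y → Graph.adj G x y ≡ Graph.adj G y x)
  (adj-irr : ∀ x → ¬ T (Graph.adj G x x))
  (cubic   : ∀ x → countB (Graph.adj G x) (Graph.verts G) ≡ 3)
  (listed  : ∀ x → x ∈ Graph.verts G) where
  open Graph G

  N : V → (V → ℕ) → ℕ
  N x q = ∑ verts (λ y → ⟦ adj x y ⟧ * q y)

  E : (V → ℕ) → (V → ℕ) → ℕ
  E p q = ∑ verts (λ x → p x * N x q)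

  active inactive : VSet G → V → ℕ
  active   A x = ⟦ A x ⟧
  inactive A x = ⟦ not (A x) ⟧

  cut : VSet G → ℕ
  cut A = E (active A) (inactive A)

  order : ℕ
  order = size G (λ _ → true)

  E-sym : ∀ p q → E p q ≡ E q p
  E-sym p q = begin
    ∑ verts (λ x → p x * N x q)                              ≡⟨ ∑-cong verts (λ x → sym (∑-*ˡ verts (p x) _)) ⟩
    ∑ verts (λ x → ∑ verts (λ y → p x * (⟦ adj x y ⟧ * q y))) ≡⟨ ∑-swap verts verts _ ⟩
    ∑ verts (λ y → ∑ verts (λ x → p x * (⟦ adj x y ⟧ * q y))) ≡⟨ ∑-cong verts (λ y → ∑-cong verts (λ x → swap-ends x y)) ⟩
    ∑ verts (λ y → ∑ verts (λ x → q y * (⟦ adj y x ⟧ * p x))) ≡⟨ ∑-cong verts (λ y → ∑-*ˡ verts (q y) _) ⟩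
    ∑ verts (λ y → q y * N y p)                              ∎
    where
    open ≡-Reasoning
    swap-ends : ∀ x y → p x * (⟦ adj x y ⟧ * q y) ≡ q y * (⟦ adj y x ⟧ * p x)
    swap-ends x y rewrite adj-sym x y = *-swap-ends (p x) ⟦ adj y x ⟧ (q y)

  N-+ : ∀ x {q q₁ q₂ : V → ℕ} → (∀ y → q y ≡ q₁ y + q₂ y) → N x q ≡ N x q₁ + N x q₂
  N-+ x {q} {q₁} {q₂} e =
    trans (∑-cong verts (λ y → trans (cong (⟦ adj x y ⟧ *_) (e y)) (*-distribˡ-+ ⟦ adj x y ⟧ (q₁ y) (q₂ y))))
          (∑-+ verts (λ y → ⟦ adj x y ⟧ * q₁ y) (λ y → ⟦ adj x y ⟧ * q₂ y))

  E-+ʳ : ∀ p {q q₁ q₂ : V → ℕ} → (∀ y → q y ≡ q₁ y + q₂ y) → E p q ≡ E p q₁ + E p q₂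
  E-+ʳ p {q} {q₁} {q₂} e =
    trans (∑-cong verts (λ x → trans (cong (p x *_) (N-+ x e)) (*-distribˡ-+ (p x) (N x q₁) (N x q₂))))
          (∑-+ verts (λ x → p x * N x q₁) (λ x → p x * N x q₂))

  E-+ˡ : ∀ {p p₁ p₂ : V → ℕ} q → (∀ x → p x ≡ p₁ x + p₂ x) → E p q ≡ E p₁ q + E p₂ q
  E-+ˡ {p} {p₁} {p₂} q e =
    trans (∑-cong verts (λ x → trans (cong (_* N x q) (e x)) (*-distribʳ-+ (N x q) (p₁ x) (p₂ x))))
          (∑-+ verts (λ x → p₁ x * N x q) (λ x → p₂ x * N x q))

  E-congʳ : ∀ p {q q′ : V → ℕ} → (∀ y → q y ≡ q′ y) → E p q ≡ E p q′
  E-congʳ p e = ∑-cong verts (λ x → cong (p x *_) (∑-cong verts (λ y → cong (⟦ adj x y ⟧ *_) (e y))))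

  N-mono : ∀ x {q q′ : V → ℕ} → (∀ y → q y ≤ q′ y) → N x q ≤ N x q′
  N-mono x le = ∑-mono verts (λ y → *-monoʳ-≤ ⟦ adj x y ⟧ (le y))

  N-one : ∀ x → N x (λ _ → 1) ≡ 3
  N-one x = trans (∑-cong verts (λ y → *-identityʳ ⟦ adj x y ⟧)) (trans (sym (countB≡∑ (adj x) verts)) (cubic x))

  N-active+inactive : ∀ x A → N x (active A) + N x (inactive A) ≡ 3
  N-active+inactive x A = trans (sym (N-+ x (λ y → sym (⟦b⟧+⟦¬b⟧ (A y))))) (N-one x)

  activeNbrs≡N : ∀ A x → activeNbrs G A x ≡ N x (active A)
  activeNbrs≡N A x = trans (countB≡∑ _ verts) (∑-cong verts (λ y → ⟦∧⟧ (adj x y) (A y)))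

  size≡∑ : ∀ A → size G A ≡ ∑ verts (active A)
  size≡∑ A = countB≡∑ A verts

  no-inactive⇒complete : ∀ A → ∑ verts (inactive A) ≡ 0 → ∀ x → T (A x)
  no-inactive⇒complete A none x with A x in ax
  ... | true  = tt
  ... | false = contradiction (subst (1 ≤_) none (∑-≥-term verts (inactive A) (listed x) x-inactive)) λ ()
    where
    x-inactive : 1 ≤ inactive A x
    x-inactive = subst (λ b → 1 ≤ ⟦ not b ⟧) (sym ax) ≤-refl

  size-complete : ∀ A → (∀ x → T (A x)) → size G A ≡ order
  size-complete A all = countB-cong verts (λ x → Equivalence.to T-≡ (all x))

  module OneStep (A : VSet G) where
    A′ : VSet G
    A′ = step G 2 A

    isNew : V → Bool
    isNew x = A′ x ∧ not (A x)

    new : V → ℕ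
    new x = ⟦ isNew x ⟧

    D : ℕ
    D = ∑ verts new

    new⇒2-active : ∀ x → T (isNew x) → 2 ≤ N x (active A)
    new⇒2-active x t = subst (2 ≤_) (activeNbrs≡N A x)
      (≤ᵇ⇒≤ 2 _ (newly-active⇒cause (A x) (2 ≤ᵇ activeNbrs G A x) t))

    -- active-before and inactive-after neighbours are disjoint
    neighbours-≤3 : ∀ x → N x (active A) + N x (inactive A′) ≤ 3
    neighbours-≤3 x = begin
      N x (active A) + N x (inactive A′) ≤⟨ +-monoʳ-≤ (N x (active A)) (N-mono x (λ y → inactive-shrinks (A y) _)) ⟩
      N x (active A) + N x (inactive A)  ≡⟨ N-active+inactive x A ⟩
      3                                  ∎
      where open ≤-Reasoning

    new-edges : E new (inactive A′) + D ≤ E new (active A)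
    new-edges = begin
      E new (inactive A′) + D                           ≡⟨ sym (∑-+ verts _ new) ⟩
      ∑ verts (λ x → new x * N x (inactive A′) + new x)  ≤⟨ ∑-mono verts per-vertex ⟩
      E new (active A)                                  ∎
      where
      open ≤-Reasoning
      per-vertex : ∀ x → new x * N x (inactive A′) + new x ≤ new x * N x (active A)
      per-vertex x = begin
        new x * N x (inactive A′) + new x     ≡⟨ cong (new x * N x (inactive A′) +_) (sym (*-identityʳ (new x))) ⟩
        new x * N x (inactive A′) + new x * 1 ≡⟨ sym (*-distribˡ-+ (new x) _ 1) ⟩
        new x * (N x (inactive A′) + 1)       ≤⟨ indicator-scale (isNew x) (λ t →
                                                    newcomer-arith (new⇒2-active x t) (neighbours-≤3 x)) ⟩
        new x * N x (active A)                ∎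

    cut-step : cut A′ + D ≤ cut A
    cut-step = begin
      cut A′ + D                                       ≡⟨ cong (_+ D) (E-+ˡ {active A′} {active A} {new} (inactive A′) (λ x → active-split (A x) _)) ⟩
      E (active A) (inactive A′) + E new (inactive A′) + D ≡⟨ +-assoc (E (active A) (inactive A′)) _ D ⟩
      E (active A) (inactive A′) + (E new (inactive A′) + D) ≤⟨ +-monoʳ-≤ (E (active A) (inactive A′)) new-edges ⟩
      E (active A) (inactive A′) + E new (active A)    ≡⟨ cong (E (active A) (inactive A′) +_) (E-sym new (active A)) ⟩
      E (active A) (inactive A′) + E (active A) new    ≡⟨ +-comm (E (active A) (inactive A′)) _ ⟩
      E (active A) new + E (active A) (inactive A′)    ≡⟨ sym (E-+ʳ (active A) (λ y → inactive-split (A y) _)) ⟩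
      cut A                                            ∎
      where open ≤-Reasoning

    size-step : size G A′ ≡ size G A + D
    size-step = begin
      size G A′                                ≡⟨ size≡∑ A′ ⟩
      ∑ verts (active A′)                      ≡⟨ ∑-cong verts (λ x → active-split (A x) _) ⟩
      ∑ verts (λ x → active A x + new x)       ≡⟨ ∑-+ verts (active A) new ⟩
      ∑ verts (active A) + D                   ≡⟨ cong (_+ D) (sym (size≡∑ A)) ⟩
      size G A + D                             ∎
      where open ≡-Reasoning

    module FinalRound (complete : ∀ x → T (A′ x)) (incomplete : 1 ≤ ∑ verts (inactive A)) where
      new≡inactive : ∀ x → new x ≡ inactive A x
      new≡inactive x = complete⇒new≡inactive (A x) _ (complete x)

      D≡inactive : D ≡ ∑ verts (inactive A)
      D≡inactive = ∑-cong verts new≡inactive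

      cut≡E-new : cut A ≡ E new (active A)
      cut≡E-new = trans (E-congʳ (active A) (λ y → sym (new≡inactive y))) (E-sym (active A) new)

      -- if only one vertex is new, it has no new neighbour (the graph has no loops)
      lone-newcomer : D ≡ 1 → ∀ x → T (isNew x) → N x new ≡ 0
      lone-newcomer D≡1 x t = n≤0⇒n≡0 (≮⇒≥ has-new-neighbour)
        where
        has-new-neighbour : ¬ 0 < N x new
        has-new-neighbour pos with ∑-positive verts _ pos
        ... | y , y∈ , adj-new with indicator-positive (adj x y) (new y) adj-new
        ... | x~y , new-y = <-irrefl (sym D≡1) (∑-≥-two verts new (listed x) y∈ x≢y (T⇒1≤⟦⟧ t) new-y)
          where
          x≢y : ¬ x ≡ y
          x≢y refl = adj-irr x x~y

      lone-newcomer-surrounded : D ≡ 1 → ∀ x → T (isNew x) → N x (active A) ≡ 3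
      lone-newcomer-surrounded D≡1 x t = begin
        N x (active A)                ≡⟨ sym (+-identityʳ _) ⟩
        N x (active A) + 0            ≡⟨ cong (N x (active A) +_) (sym (lone-newcomer D≡1 x t)) ⟩
        N x (active A) + N x new      ≡⟨ sym (N-+ x (λ y → trans (sym (⟦b⟧+⟦¬b⟧ (A y))) (cong (active A y +_) (sym (new≡inactive y))))) ⟩
        N x (λ _ → 1)                 ≡⟨ N-one x ⟩
        3                             ∎
        where open ≡-Reasoning

      E-new-≥ : ∀ k → (∀ x → T (isNew x) → k ≤ N x (active A)) → D * k ≤ E new (active A)
      E-new-≥ k h = begin
        D * k                         ≡⟨ sym (∑-*ʳ verts k new) ⟩
        ∑ verts (λ x → new x * k)      ≤⟨ ∑-mono verts (λ x → indicator-scale (isNew x) (h x)) ⟩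
        E new (active A)              ∎
        where open ≤-Reasoning

      -- D = 1: the newcomer has 3 active neighbours; D ≥ 2: each newcomer has ≥ 2
      final-drop : D + 2 ≤ cut A
      final-drop = subst (D + 2 ≤_) (sym cut≡E-new) (bound D refl)
        where
        bound : ∀ d → d ≡ D → d + 2 ≤ E new (active A)
        bound 0             0≡D = contradiction (subst (1 ≤_) (trans (sym D≡inactive) (sym 0≡D)) incomplete) λ ()
        bound 1             1≡D = subst (λ d → d * 3 ≤ E new (active A)) (sym 1≡D)
                                    (E-new-≥ 3 (λ x t → ≤-reflexive (sym (lone-newcomer-surrounded (sym 1≡D) x t))))
        bound d@(suc (suc _)) d≡D = ≤-trans (double-gain d (s≤s (s≤s z≤n)))
                                    (subst (λ d → d * 2 ≤ E new (active A)) (sym d≡D) (E-new-≥ 2 new⇒2-active))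

  module Run (S : VSet G) where
    At : ℕ → VSet G
    At t = activeAt G 2 S t

    weight-decreases : ∀ t → cut (At t) + size G (At t) ≤ cut S + size G S
    weight-decreases zero    = ≤-refl
    weight-decreases (suc t) = ≤-trans one-round (weight-decreases t)
      where
      open OneStep (At t)
      open ≤-Reasoning
      one-round : cut A′ + size G A′ ≤ cut (At t) + size G (At t)
      one-round = begin
        cut A′ + size G A′             ≡⟨ cong (cut A′ +_) (trans size-step (+-comm _ D)) ⟩
        cut A′ + (D + size G (At t))   ≡⟨ sym (+-assoc (cut A′) D _) ⟩
        cut A′ + D + size G (At t)     ≤⟨ +-monoˡ-≤ _ cut-step ⟩
        cut (At t) + size G (At t)     ∎

    -- each seed vertex has at most 3 cut edges
    weight-seed : cut S + size G S ≤ 4 * size G S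
    weight-seed = begin
      cut S + size G S                  ≤⟨ +-monoˡ-≤ (size G S) cut≤3size ⟩
      3 * size G S + size G S            ≡⟨ +-comm (3 * size G S) _ ⟩
      4 * size G S                       ∎
      where
      open ≤-Reasoning
      cut≤3size : cut S ≤ 3 * size G S
      cut≤3size = begin
        cut S                              ≤⟨ ∑-mono verts (λ x → *-monoʳ-≤ (active S x) (N-≤3 x)) ⟩
        ∑ verts (λ x → active S x * 3)     ≡⟨ ∑-*ʳ verts 3 (active S) ⟩
        ∑ verts (active S) * 3             ≡⟨ *-comm (∑ verts (active S)) 3 ⟩
        3 * ∑ verts (active S)             ≡⟨ cong (3 *_) (sym (size≡∑ S)) ⟩
        3 * size G S                       ∎
        where
        N-≤3 : ∀ x → N x (inactive S) ≤ 3
        N-≤3 x = ≤-trans (N-mono x (λ y → ⟦⟧≤1 (not (S y)))) (≤-reflexive (N-one x))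

    final-round : ∀ t → (∀ x → T (At t x)) →
      (∀ x → T (S x)) ⊎ Σ ℕ (λ k → (∀ x → T (At (suc k) x)) × 1 ≤ ∑ verts (inactive (At k)))
    final-round zero    complete = inj₁ complete
    final-round (suc t) complete with ∑ verts (inactive (At t)) in e
    ... | zero  = final-round t (no-inactive⇒complete (At t) e)
    ... | suc _ = inj₂ (t , complete , subst (1 ≤_) (sym e) (s≤s z≤n))

    lower-bound : Percolates G 2 S → 1 ≤ order → order + 2 ≤ 4 * size G S
    lower-bound (t , complete) 1≤order with final-round t complete
    ... | inj₁ S-complete = subst (λ n → n + 2 ≤ 4 * size G S) (size-complete S S-complete)
                              (one-vertex-gain (size G S) (subst (1 ≤_) (sym (size-complete S S-complete)) 1≤order))
    ... | inj₂ (k , last , incomplete) = begin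
        order + 2                       ≡⟨ cong (_+ 2) (sym (size-complete A′ last)) ⟩
        size G A′ + 2                   ≡⟨ cong (_+ 2) size-step ⟩
        size G (At k) + D + 2           ≡⟨ +-assoc (size G (At k)) D 2 ⟩
        size G (At k) + (D + 2)         ≤⟨ +-monoʳ-≤ (size G (At k)) (FinalRound.final-drop last incomplete) ⟩
        size G (At k) + cut (At k)      ≡⟨ +-comm (size G (At k)) _ ⟩
        cut (At k) + size G (At k)      ≤⟨ weight-decreases k ⟩
        cut S + size G S                ≤⟨ weight-seed ⟩
        4 * size G S                    ∎
      where
      open OneStep (At k)
      open ≤-Reasoning

-- Monotonicity and the threshold-2 activation rule, in any graph

module Activation (G : Graph) (listed : ∀ x → x ∈ Graph.verts G) (S : VSet G) where
  open Graph G

  At : ℕ → VSet G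
  At t = activeAt G 2 S t

  stays-active : ∀ x t t′ → t ≤ t′ → T (At t x) → T (At t′ x)
  stays-active x t t′ t≤t′ x-on = subst (λ τ → T (At τ x)) (m∸n+n≡m t≤t′) (later (t′ ∸ t))
    where
    later : ∀ Δ → T (At (Δ + t) x)
    later zero    = x-on
    later (suc Δ) = Equivalence.from T-∨ (inj₁ (later Δ))

  two-neighbours : ∀ t x y z → ¬ y ≡ z → T (adj x y) → T (adj x z) →
                   T (At t y) → T (At t z) → T (At (suc t) x)
  two-neighbours t x y z y≢z x~y x~z y-on z-on = Equivalence.from T-∨ (inj₂ (≤⇒≤ᵇ two-active))
    where
    two-active : 2 ≤ activeNbrs G (At t) x
    two-active = at-least-two _ verts (listed y) (listed z) y≢z
                   (Equivalence.from T-∧ (x~y , y-on)) (Equivalence.from T-∧ (x~z , z-on))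

-- Residues modulo m and the circulant adjacency i ~ i ± d

module Residues (m : ℕ) .{{_ : NonZero m}} where

  %-+ˡ : ∀ a b → (a % m + b) % m ≡ (a + b) % m
  %-+ˡ a b = begin
    (a % m + b) % m          ≡⟨ %-distribˡ-+ (a % m) b m ⟩
    (a % m % m + b % m) % m  ≡⟨ cong (λ z → (z + b % m) % m) (m%n%n≡m%n a m) ⟩
    (a % m + b % m) % m      ≡⟨ sym (%-distribˡ-+ a b m) ⟩
    (a + b) % m              ∎
    where open ≡-Reasoning

  *-congʳ-% : ∀ {a b} c → a % m ≡ b % m → (a * c) % m ≡ (b * c) % m
  *-congʳ-% {a} {b} c e = begin
    (a * c) % m              ≡⟨ %-distribˡ-* a c m ⟩
    (a % m * (c % m)) % m    ≡⟨ cong (λ z → (z * (c % m)) % m) e ⟩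
    (b % m * (c % m)) % m    ≡⟨ sym (%-distribˡ-* b c m) ⟩
    (b * c) % m              ∎
    where open ≡-Reasoning

  *-congˡ-% : ∀ {a b} c → a % m ≡ b % m → (c * a) % m ≡ (c * b) % m
  *-congˡ-% {a} {b} c e = trans (cong (_% m) (*-comm c a)) (trans (*-congʳ-% c e) (cong (_% m) (*-comm b c)))

  +-cancelˡ-% : ∀ i a b → (i + a) % m ≡ (i + b) % m → a % m ≡ b % m
  +-cancelˡ-% i a b e = trans (sym (translate-back a)) (trans (cong (λ z → (z + (m ∸ r)) % m) e) (translate-back b))
    where
    r = i % m
    translate-back : ∀ a → ((i + a) % m + (m ∸ r)) % m ≡ a % m
    translate-back a = begin
      ((i + a) % m + (m ∸ r)) % m  ≡⟨ %-+ˡ (i + a) (m ∸ r) ⟩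
      (i + a + (m ∸ r)) % m        ≡⟨ cong (_% m) (+-assoc i a (m ∸ r)) ⟩
      (i + (a + (m ∸ r))) % m      ≡⟨ sym (%-+ˡ i (a + (m ∸ r))) ⟩
      (r + (a + (m ∸ r))) % m      ≡⟨ cong (_% m) (x∙yz≈y∙xz r a (m ∸ r)) ⟩
      (a + (r + (m ∸ r))) % m      ≡⟨ cong (λ z → (a + z) % m) (m+[n∸m]≡n (<⇒≤ (m%n<n i m))) ⟩
      (a + m) % m                  ≡⟨ [m+n]%n≡m%n a m ⟩
      a % m                        ∎
      where open ≡-Reasoning

  idx : ℕ → Fin m
  idx k = fromℕ< (m%n<n k m)

  toℕ-idx : ∀ k → toℕ (idx k) ≡ k % m
  toℕ-idx k = toℕ-fromℕ< (m%n<n k m)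

  idx-cong : ∀ {a b} → a % m ≡ b % m → idx a ≡ idx b
  idx-cong {a} {b} e = toℕ-injective (trans (toℕ-idx a) (trans e (sym (toℕ-idx b))))

  idx-toℕ : ∀ i → idx (toℕ i) ≡ i
  idx-toℕ i = toℕ-injective (trans (toℕ-idx (toℕ i)) (m<n⇒m%n≡m (toℕ<n i)))

  count-index : ∀ c → c < m → countB (λ j → c ≡ᵇ toℕ j) (allFin m) ≡ 1
  count-index c c<m = ≤-antisym (at-most-one _ (allFin m) (allFin⁺ m) same) (at-least-one _ (allFin m) (∈-allFin (idx c)) hit)
    where
    same : ∀ x y → T (c ≡ᵇ toℕ x) → T (c ≡ᵇ toℕ y) → x ≡ y
    same x y cx cy = toℕ-injective (trans (sym (≡ᵇ⇒≡ c (toℕ x) cx)) (≡ᵇ⇒≡ c (toℕ y) cy))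
    hit : T (c ≡ᵇ toℕ (idx c))
    hit = ≡⇒≡ᵇ _ _ (sym (trans (toℕ-idx c) (m<n⇒m%n≡m c<m)))

  -- adjacency in the circulant graph with jump d, written as in Petersen
  ringAdj : ℕ → Fin m → Fin m → Bool
  ringAdj d i j = (toℕ j ≡ᵇ ((toℕ i + d) % m)) ∨ (toℕ i ≡ᵇ ((toℕ j + d) % m))

  ring-sym : ∀ d i j → ringAdj d i j ≡ ringAdj d j i
  ring-sym d i j = ∨-comm (toℕ j ≡ᵇ ((toℕ i + d) % m)) _

  ring-step : ∀ d k → T (ringAdj d (idx k) (idx (d + k)))
  ring-step d k = Equivalence.from T-∨ (inj₁ (≡⇒≡ᵇ _ _ forward))
    where
    forward : toℕ (idx (d + k)) ≡ (toℕ (idx k) + d) % m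
    forward = begin
      toℕ (idx (d + k))         ≡⟨ toℕ-idx (d + k) ⟩
      (d + k) % m               ≡⟨ cong (_% m) (+-comm d k) ⟩
      (k + d) % m               ≡⟨ sym (%-+ˡ k d) ⟩
      (k % m + d) % m           ≡⟨ cong (λ z → (z + d) % m) (sym (toℕ-idx k)) ⟩
      (toℕ (idx k) + d) % m     ∎
      where open ≡-Reasoning

  ring-irreflexive : ∀ d i → 0 < d → d < m → ¬ T (ringAdj d i i)
  ring-irreflexive d i 0<d d<m loop = <-irrefl (sym d≡0) 0<d
    where
    I = toℕ i
    I≡I+d : I ≡ (I + d) % m
    I≡I+d = [ ≡ᵇ⇒≡ _ _ , ≡ᵇ⇒≡ _ _ ]′ (Equivalence.to T-∨ loop)
    d≡0 : d ≡ 0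
    d≡0 = begin
      d        ≡⟨ sym (m<n⇒m%n≡m d<m) ⟩
      d % m    ≡⟨ +-cancelˡ-% I d 0 (trans (sym I≡I+d) (trans (sym (m<n⇒m%n≡m (toℕ<n i))) (cong (_% m) (sym (+-identityʳ I))))) ⟩
      0 % m    ≡⟨ m<n⇒m%n≡m (>-nonZero⁻¹ m) ⟩
      0        ∎
      where open ≡-Reasoning

  ring-degree : ∀ d i → 0 < d → d + d < m → countB (ringAdj d i) (allFin m) ≡ 2
  ring-degree d i 0<d 2d<m = ≤-antisym at-most at-least
    where
    I = toℕ i
    d<m : d < m
    d<m = <-trans (m<m+n d 0<d) 2d<m
    m∸d<m : m ∸ d < m
    m∸d<m = ∸-monoʳ-< 0<d (<⇒≤ d<m)
    forward backward : Fin m → Bool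
    forward  j = toℕ j ≡ᵇ ((I + d) % m)
    backward j = I ≡ᵇ ((toℕ j + d) % m)
    at-most : countB (ringAdj d i) (allFin m) ≤ 2
    at-most = ≤-trans (countB-∨ forward backward (allFin m))
      (+-mono-≤ (at-most-one forward (allFin m) (allFin⁺ m)
                   (λ x y fx fy → toℕ-injective (trans (≡ᵇ⇒≡ (toℕ x) _ fx) (sym (≡ᵇ⇒≡ (toℕ y) _ fy)))))
                (at-most-one backward (allFin m) (allFin⁺ m)
                   (λ x y bx by → toℕ-injective (backward-injective x y (trans (sym (≡ᵇ⇒≡ I _ bx)) (≡ᵇ⇒≡ I _ by))))))
      where
      backward-injective : ∀ x y → (toℕ x + d) % m ≡ (toℕ y + d) % m → toℕ x ≡ toℕ y
      backward-injective x y e = begin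
        toℕ x        ≡⟨ sym (m<n⇒m%n≡m (toℕ<n x)) ⟩
        toℕ x % m    ≡⟨ +-cancelˡ-% d (toℕ x) (toℕ y) (trans (cong (_% m) (+-comm d (toℕ x))) (trans e (cong (_% m) (+-comm (toℕ y) d)))) ⟩
        toℕ y % m    ≡⟨ m<n⇒m%n≡m (toℕ<n y) ⟩
        toℕ y        ∎
        where open ≡-Reasoning
    j₊ j₋ : Fin m
    j₊ = idx (I + d)
    j₋ = idx (I + (m ∸ d))
    j₊-adj : T (ringAdj d i j₊)
    j₊-adj = Equivalence.from T-∨ (inj₁ (≡⇒≡ᵇ _ _ (toℕ-idx (I + d))))
    j₋-adj : T (ringAdj d i j₋)
    j₋-adj = Equivalence.from T-∨ (inj₂ (≡⇒≡ᵇ _ _ (sym back)))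
      where
      back : (toℕ j₋ + d) % m ≡ I
      back = begin
        (toℕ j₋ + d) % m              ≡⟨ cong (λ z → (z + d) % m) (toℕ-idx (I + (m ∸ d))) ⟩
        ((I + (m ∸ d)) % m + d) % m   ≡⟨ %-+ˡ (I + (m ∸ d)) d ⟩
        (I + (m ∸ d) + d) % m         ≡⟨ cong (_% m) (+-assoc I (m ∸ d) d) ⟩
        (I + (m ∸ d + d)) % m         ≡⟨ cong (λ z → (I + z) % m) (m∸n+n≡m (<⇒≤ d<m)) ⟩
        (I + m) % m                   ≡⟨ [m+n]%n≡m%n I m ⟩
        I % m                         ≡⟨ m<n⇒m%n≡m (toℕ<n i) ⟩
        I                             ∎
        where open ≡-Reasoning
    -- j₊ = j₋ would force d ≡ m - d, i.e. 2d = m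
    j₊≢j₋ : ¬ j₊ ≡ j₋
    j₊≢j₋ e = <-irrefl (trans (cong (d +_) d≡m∸d) (m+[n∸m]≡n (<⇒≤ d<m))) 2d<m
      where
      d≡m∸d : d ≡ m ∸ d
      d≡m∸d = begin
        d            ≡⟨ sym (m<n⇒m%n≡m d<m) ⟩
        d % m        ≡⟨ +-cancelˡ-% I d (m ∸ d) (trans (sym (toℕ-idx (I + d))) (trans (cong toℕ e) (toℕ-idx (I + (m ∸ d))))) ⟩
        (m ∸ d) % m  ≡⟨ m<n⇒m%n≡m m∸d<m ⟩
        m ∸ d        ∎
        where open ≡-Reasoning
    at-least : 2 ≤ countB (ringAdj d i) (allFin m)
    at-least = at-least-two (ringAdj d i) (allFin m) (∈-allFin j₊) (∈-allFin j₋) j₊≢j₋ j₊-adj j₋-adj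

⌊n/2⌋+⌊n/2⌋≤n : ∀ n → ⌊ n /2⌋ + ⌊ n /2⌋ ≤ n
⌊n/2⌋+⌊n/2⌋≤n n = ≤-trans (+-monoʳ-≤ ⌊ n /2⌋ (⌊n/2⌋≤⌈n/2⌉ n)) (≤-reflexive (⌊n/2⌋+⌈n/2⌉≡n n))

-- the hypothesis s ≤ ⌊(m-1)/2⌋ says that the inner jump is short: 2s < m
double-jump<m : ∀ m s → 1 ≤ m → s ≤ ⌊ m ∸ 1 /2⌋ → s + s < m
double-jump<m m s 1≤m s≤ = ≤-<-trans (≤-trans (+-mono-≤ s≤ s≤) (⌊n/2⌋+⌊n/2⌋≤n (m ∸ 1))) (∸-monoʳ-< {m} {1} {0} (s≤s z≤n) 1≤m)

ceil-half-bound : ∀ n z → n + n + 2 ≤ 4 * z → ⌈ n + 1 /2⌉ ≤ z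
ceil-half-bound n z h rewrite +-comm n 1 with suc ⌊ n /2⌋ ≤? z
... | yes ok = ok
... | no too-small = contradiction h (<⇒≱ (begin-strict
    4 * z                    ≤⟨ *-monoʳ-≤ 4 (s≤s⁻¹ (≰⇒> too-small)) ⟩
    4 * ⌊ n /2⌋              ≡⟨ four-halves ⌊ n /2⌋ ⟩
    (⌊ n /2⌋ + ⌊ n /2⌋) + (⌊ n /2⌋ + ⌊ n /2⌋) ≤⟨ +-mono-≤ (⌊n/2⌋+⌊n/2⌋≤n n) (⌊n/2⌋+⌊n/2⌋≤n n) ⟩
    n + n                    <⟨ m<m+n (n + n) (s≤s z≤n) ⟩
    n + n + 2                ∎))
  where
  open ≤-Reasoning
  four-halves : ∀ h → 4 * h ≡ (h + h) + (h + h)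
  four-halves = solve 1 (λ h → con 4 :* h := (h :+ h) :+ (h :+ h)) refl
    where open +-*-Solver using (solve; con; _:*_; _:+_; _:=_)

-- rearranging a Bézout identity 1 + y s = x m with m = p + 1
bezout-rearrange : ∀ p y s → p * y * s + suc p ≡ 1 + p * (1 + y * s)
bezout-rearrange = solve 3 (λ p y s → p :* y :* s :+ (con 1 :+ p) := con 1 :+ p :* (con 1 :+ y :* s)) refl
  where open +-*-Solver using (solve; con; _:*_; _:+_; _:=_)

alternating : Bool → ℕ → Bool
alternating b zero    = b
alternating b (suc k) = alternating (not b) k

odd : ℕ → Bool
odd = alternating false

alternating-not : ∀ b k → alternating (not b) k ≡ not (alternating b k)
alternating-not b     zero    = refl
alternating-not false (suc k) = alternating-not true k
alternating-not true  (suc k) = alternating-not false k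

countBelow : (ℕ → Bool) → ℕ → ℕ
countBelow f zero    = 0
countBelow f (suc n) = ⟦ f 0 ⟧ + countBelow (f ∘ suc) n

countB-allFin : ∀ n (f : ℕ → Bool) → countB (f ∘ toℕ) (allFin n) ≡ countBelow f n
countB-allFin zero    f = refl
countB-allFin (suc n) f = trans (countB-∷ (f ∘ toℕ) Fin.zero _) (cong (⟦ f 0 ⟧ +_) shifted)
  where
  shifted : countB (f ∘ toℕ) (tabulate {n = n} Fin.suc) ≡ countBelow (f ∘ suc) n
  shifted = trans (cong (countB (f ∘ toℕ)) (sym (map-tabulate {n = n} (λ i → i) Fin.suc)))
                  (trans (countB-map (f ∘ toℕ) Fin.suc (allFin n)) (countB-allFin n (f ∘ suc)))

count-alternating : ∀ n → countBelow (alternating false) n ≡ ⌊ n /2⌋ × countBelow (alternating true) n ≡ ⌈ n /2⌉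
count-alternating zero    = refl , refl
count-alternating (suc n) = proj₂ (count-alternating n) , cong suc (proj₁ (count-alternating n))

≡ᵇ-sym : ∀ a b → (a ≡ᵇ b) ≡ (b ≡ᵇ a)
≡ᵇ-sym zero    zero    = refl
≡ᵇ-sym zero    (suc b) = refl
≡ᵇ-sym (suc a) zero    = refl
≡ᵇ-sym (suc a) (suc b) = ≡ᵇ-sym a b

module PetersenBasics (m s : ℕ) .{{_ : NonZero m}} where
  open Residues m
  open Graph (Petersen m s)

  listed : ∀ x → x ∈ verts
  listed (inj₁ i) = ∈-++⁺ˡ (∈-map⁺ inj₁ (∈-allFin i))
  listed (inj₂ i) = ∈-++⁺ʳ (map inj₁ (allFin m)) (∈-map⁺ inj₂ (∈-allFin i))

  count-vertices : (p : V → Bool) → countB p verts ≡ countB (p ∘ inj₁) (allFin m) + countB (p ∘ inj₂) (allFin m)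
  count-vertices p = trans (countB-++ p (map inj₁ (allFin m)) (map inj₂ (allFin m))) (cong₂ _+_ (countB-map p inj₁ (allFin m)) (countB-map p inj₂ (allFin m)))

  order≡2m : size (Petersen m s) (λ _ → true) ≡ m + m
  order≡2m = trans (count-vertices (λ _ → true)) (cong₂ _+_ all-indices all-indices)
    where
    all-indices : countB (λ _ → true) (allFin m) ≡ m
    all-indices = trans (countB-true (allFin m)) (length-tabulate _)

  adj-sym : ∀ x y → adj x y ≡ adj y x
  adj-sym (inj₁ i) (inj₁ j) = ring-sym 1 i j
  adj-sym (inj₂ i) (inj₂ j) = ring-sym s i j
  adj-sym (inj₁ i) (inj₂ j) = ≡ᵇ-sym (toℕ i) (toℕ j)
  adj-sym (inj₂ i) (inj₁ j) = ≡ᵇ-sym (toℕ i) (toℕ j)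

  module Cubic (3≤m : 3 ≤ m) (0<s : 0 < s) (2s<m : s + s < m) where
    adj-irr : ∀ x → ¬ T (adj x x)
    adj-irr (inj₁ i) = ring-irreflexive 1 i (s≤s z≤n) (<-trans (s≤s (s≤s z≤n)) 3≤m)
    adj-irr (inj₂ i) = ring-irreflexive s i 0<s (<-trans (m<m+n s 0<s) 2s<m)

    cubic : ∀ x → countB (adj x) verts ≡ 3
    cubic (inj₁ i) = trans (count-vertices (adj (inj₁ i))) (cong₂ _+_ (ring-degree 1 i (s≤s z≤n) 3≤m) (count-index (toℕ i) (toℕ<n i)))
    cubic (inj₂ i) = trans (count-vertices (adj (inj₂ i))) (cong₂ _+_ (count-index (toℕ i) (toℕ<n i)) (ring-degree s i 0<s 2s<m))

-- The seed {v_k : k odd} ∪ {u_0} activates all of P(m,s) when gcd(m,s) = 1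

module Spreading (m s : ℕ) .{{_ : NonZero m}} (3≤m : 3 ≤ m) (coprime : gcd m s ≡ 1) where
  open Residues m
  open PetersenBasics m s
  open Graph (Petersen m s)

  seed : V → Bool
  seed (inj₁ i) = odd (toℕ i)
  seed (inj₂ i) = 0 ≡ᵇ toℕ i

  open Activation (Petersen m s) listed seed

  seed-size : size (Petersen m s) seed ≡ ⌈ m + 1 /2⌉
  seed-size = begin
    size (Petersen m s) seed     ≡⟨ count-vertices seed ⟩
    countB (odd ∘ toℕ) (allFin m) + countB (λ j → 0 ≡ᵇ toℕ j) (allFin m)
                                 ≡⟨ cong₂ _+_ (trans (countB-allFin m odd) (proj₁ (count-alternating m))) (count-index 0 0<m) ⟩
    ⌊ m /2⌋ + 1                  ≡⟨ +-comm ⌊ m /2⌋ 1 ⟩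
    ⌊ 2 + m /2⌋                  ≡⟨ cong (λ n → ⌈ n /2⌉) (+-comm 1 m) ⟩
    ⌈ m + 1 /2⌉                  ∎
    where
    open ≡-Reasoning
    0<m : 0 < m
    0<m = >-nonZero⁻¹ m

  v u : ℕ → V
  v k = inj₁ (idx k)
  u k = inj₂ (idx k)

  v-mod : ∀ {a b} → v a ≡ v b → a % m ≡ b % m
  v-mod {a} {b} e = trans (sym (toℕ-idx a)) (trans (cong toℕ (inj₁-injective e)) (toℕ-idx b))

  v-next : ∀ k → T (adj (v k) (v (1 + k)))
  v-next k = ring-step 1 k

  v-prev : ∀ k → T (adj (v (1 + k)) (v k))
  v-prev k = subst T (ring-sym 1 (idx k) (idx (1 + k))) (ring-step 1 k)

  u-prev : ∀ k → T (adj (u (s + k)) (u k))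
  u-prev k = subst T (ring-sym s (idx k) (idx (s + k))) (ring-step s k)

  spoke-vu : ∀ k → T (adj (v k) (u k))
  spoke-vu k = ≡⇒≡ᵇ (toℕ (idx k)) _ refl

  spoke-uv : ∀ k → T (adj (u k) (v k))
  spoke-uv k = ≡⇒≡ᵇ (toℕ (idx k)) _ refl

  seed-v : ∀ k → k < m → odd k ≡ true → T (At 0 (v k))
  seed-v k k<m odd-k = subst T (sym (trans (cong odd (trans (toℕ-idx k) (m<n⇒m%n≡m k<m))) odd-k)) tt

  seed-u₀ : T (At 0 (u 0))
  seed-u₀ = ≡⇒≡ᵇ 0 (toℕ (idx 0)) (sym (trans (toℕ-idx 0) (m<n⇒m%n≡m (>-nonZero⁻¹ m))))

  v₀-round1 : T (At 1 (v 0))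
  v₀-round1 = two-neighbours 0 (v 0) (v 1) (u 0) (λ ()) (v-next 0) (spoke-vu 0)
                (seed-v 1 (<-trans (s≤s (s≤s z≤n)) 3≤m) refl) seed-u₀

  -- the successor v_{j+2} of an odd seed v_j is active after one round (it is v_0 if j + 2 = m)
  v-after-odd : ∀ j → odd j ≡ true → 2 + j ≤ m → T (At 1 (v (2 + j)))
  v-after-odd j odd-j 2+j≤m with 2 + j <? m
  ... | yes 2+j<m = stays-active (v (2 + j)) 0 1 z≤n (seed-v (2 + j) 2+j<m odd-j)
  ... | no  2+j≮m = subst (λ w → T (At 1 (inj₁ w))) (idx-cong 0≡2+j) v₀-round1
    where
    0≡2+j : 0 % m ≡ (2 + j) % m
    0≡2+j = trans (m<n⇒m%n≡m (>-nonZero⁻¹ m)) (sym (trans (cong (_% m) (≤-antisym 2+j≤m (≮⇒≥ 2+j≮m))) (n%n≡0 m)))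

  v-two-apart : ∀ j → ¬ v j ≡ v (2 + j)
  v-two-apart j e = contradiction (trans (sym (m<n⇒m%n≡m (>-nonZero⁻¹ m))) (trans 0≡2 (m<n⇒m%n≡m 3≤m))) λ ()
    where
    0≡2 : 0 % m ≡ 2 % m
    0≡2 = +-cancelˡ-% j 0 2 (trans (cong (_% m) (+-identityʳ j)) (trans (v-mod e) (cong (_% m) (+-comm 2 j))))

  outer-cycle : ∀ k → k < m → T (At 2 (v k))
  outer-cycle zero    _ = stays-active (v 0) 1 2 (s≤s z≤n) v₀-round1
  outer-cycle (suc j) k<m with odd (suc j) in odd-k
  ... | true  = stays-active (v (suc j)) 0 2 z≤n (seed-v (suc j) k<m odd-k)
  ... | false = two-neighbours 1 (v (suc j)) (v j) (v (2 + j)) (v-two-apart j) (v-prev j) (v-next (suc j))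
                  (stays-active (v j) 0 1 z≤n (seed-v j (<-trans (n<1+n j) k<m) odd-j)) (v-after-odd j odd-j k<m)
    where
    odd-j : odd j ≡ true
    odd-j = not-injective {y = true} (trans (sym (alternating-not false j)) odd-k)

  outer : ∀ k → T (At 2 (v k))
  outer k = subst (λ w → T (At 2 (inj₁ w))) (idx-cong (m%n%n≡m%n k m)) (outer-cycle (k % m) (m%n<n k m))

  -- u_{ns} is active after n + 2 rounds: it sees u_{(n-1)s} and the outer vertex v_{ns}
  inner-chain : ∀ n → T (At (2 + n) (u (n * s)))
  inner-chain zero    = stays-active (u 0) 0 2 z≤n seed-u₀
  inner-chain (suc n) = two-neighbours (2 + n) (u (s + n * s)) (u (n * s)) (v (s + n * s)) (λ ())
                          (u-prev (n * s)) (spoke-uv (s + n * s)) (inner-chain n)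
                          (stays-active (v (s + n * s)) 2 (2 + n) (m≤m+n 2 n) (outer (s + n * s)))

  s-inverse : Σ ℕ λ w → (w * s) % m ≡ 1 % m
  s-inverse with subst (λ d → Bézout.Identity d m s) coprime (Bézout.identity (gcd-GCD m s))
  ... | Bézout.-+ x y eq = y , trans (cong (_% m) (sym eq)) ([m+kn]%n≡m%n 1 x m)
  ... | Bézout.+- x y eq = pred m * y , (begin
      (pred m * y * s) % m          ≡⟨ sym ([m+n]%n≡m%n _ m) ⟩
      (pred m * y * s + m) % m      ≡⟨ cong (λ z → (pred m * y * s + z) % m) (sym (suc-pred m)) ⟩
      (pred m * y * s + suc (pred m)) % m ≡⟨ cong (_% m) (bezout-rearrange (pred m) y s) ⟩
      (1 + pred m * (1 + y * s)) % m ≡⟨ cong (λ z → (1 + pred m * z) % m) eq ⟩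
      (1 + pred m * (x * m)) % m    ≡⟨ cong (λ z → (1 + z) % m) (sym (*-assoc (pred m) x m)) ⟩
      (1 + pred m * x * m) % m      ≡⟨ [m+kn]%n≡m%n 1 (pred m * x) m ⟩
      1 % m                         ∎)
    where open ≡-Reasoning

  multiples-cover : ∀ j → Σ ℕ λ n → n < m × (n * s) % m ≡ j % m
  multiples-cover j = n % m , m%n<n n m , (begin
    (n % m * s) % m      ≡⟨ *-congʳ-% s (m%n%n≡m%n n m) ⟩
    (j * w * s) % m      ≡⟨ cong (_% m) (*-assoc j w s) ⟩
    (j * (w * s)) % m    ≡⟨ *-congˡ-% j (proj₂ s-inverse) ⟩
    (j * 1) % m          ≡⟨ cong (_% m) (*-identityʳ j) ⟩
    j % m                ∎)
    where
    open ≡-Reasoning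
    w = proj₁ s-inverse
    n = j * w

  percolates : Percolates (Petersen m s) 2 seed
  percolates = 2 + m , all-active
    where
    all-active : ∀ x → T (At (2 + m) x)
    all-active (inj₁ i) = subst (λ w → T (At (2 + m) (inj₁ w))) (idx-toℕ i)
                            (stays-active (v (toℕ i)) 2 (2 + m) (m≤m+n 2 m) (outer (toℕ i)))
    all-active (inj₂ i) with multiples-cover (toℕ i)
    ... | n , n<m , ns≡i = subst (λ w → T (At (2 + m) (inj₂ w))) (trans (idx-cong ns≡i) (idx-toℕ i))
                              (stays-active (u (n * s)) (2 + n) (2 + m) (+-monoʳ-≤ 2 (<⇒≤ n<m)) (inner-chain n))

corollary2p4 : (m s : ℕ) → .{{_ : NonZero m}} → 3 ≤ m → 1 ≤ s → s ≤ ⌊ m ∸ 1 /2⌋ → gcd m s ≡ 1 →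
    MinSeedIs (Petersen m s) 2 ⌈ m Data.Nat.+ 1 /2⌉
corollary2p4 m s 3≤m 1≤s s≤ coprime = (seed , seed-size , percolates) , every-seed-large
  where
  1≤m : 1 ≤ m
  1≤m = ≤-trans (s≤s z≤n) 3≤m
  open Spreading m s 3≤m coprime using (seed; seed-size; percolates)
  open PetersenBasics m s using (listed; adj-sym; order≡2m)
  open PetersenBasics.Cubic m s 3≤m 1≤s (double-jump<m m s 1≤m s≤) using (adj-irr; cubic)
  open CubicGraph (Petersen m s) adj-sym adj-irr cubic listed using (module Run)

  every-seed-large : ∀ S → Percolates (Petersen m s) 2 S → ⌈ m + 1 /2⌉ ≤ size (Petersen m s) S
  every-seed-large S perc = ceil-half-bound m (size (Petersen m s) S)
    (subst (λ n → n + 2 ≤ 4 * size (Petersen m s) S) order≡2m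
      (Run.lower-bound S perc (subst (1 ≤_) (sym order≡2m) (≤-trans 1≤m (m≤m+n m m)))))
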